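{- Cut elimination holds for $\mathbf{SKt}+\mathbf P$, for any set $\mathbf P$ of path axioms.
   Context: Formulae are in negation normal form over $a,\neg a,\lor,\land,\square,\blacksquare,\lozenge,\lozenge^{\bullet}$, where $\lozenge^{\bullet}$ is the past diamond (dual of $\blacksquare$), $\overline A$ the nnf of $\neg A$. $\mathbf{SKt}$ is the shallow nested sequent calculus: $id$: $\Gamma,a,\overline a$; $cut$: from $\Gamma,A$ and $\Delta,\overline A$ infer $\Gamma,\Delta$; $\land$; $\lor$; $ctr$: from $\Gamma,\Delta,\Delta$ infer $\Gamma,\Delta$; $wk$: from $\Gamma$ infer $\Gamma,\Delta$; $rf$: from $\Gamma,\circ\{\Delta\}$ infer $\bullet\{\Gamma\},\Delta$; $rp$: from $\Gamma,\bullet\{\Delta\}$ infer $\circ\{\Gamma\},\Delta$; $\blacksquare$: from $\Gamma,\bullet\{A\}$ infer $\Gamma,\blacksquare A$; $\square$: from $\Gamma,\circ\{A\}$ infer $\Gamma,\square A$; $\lozenge^{\bullet}$: from $\Gamma,\bullet\{\Delta,A\}$ infer $\Gamma,\bullet\{\Delta\},\lozenge^{\bullet}A$; $\lozenge$: from $\Gamma,\circ\{\Delta,A\}$ infer $\Gamma,\circ\{\Delta\},\lozenge A$. A path axiom is a scheme $\langle?\rangle_1\cdots\langle?\rangle_n X\to\langle?\rangle X$, $n\ge0$, each diamond in $\{\lozenge,\lozenge^{\bullet}\}$. $\mathbf{SKt}+\mathbf P$ adds, for each axiom in $\mathbf P$, the structural rule: from $\Gamma,\star\{\Delta\}$ infer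 $\Gamma,\star_1\{\cdots\star_n\{\Delta\}\cdots\}$, where $\star$ ($\star_i$) is $\circ$ if $\langle?\rangle$ ($\langle?\rangle_i$) is $\lozenge$ and $\bullet$ if it is $\lozenge^{\bullet}$. -}

module Defs where

open import Data.Nat using (ℕ)
open import Relation.Binary.PropositionalEquality using (_≡_)
open import Data.Bool using (Bool; true; false)
open import Data.List using (List; []; _∷_; _++_; [_])
open import Data.List.Relation.Binary.Permutation.Propositional using (_↭_)

data Fm : Set where
  pos  : ℕ → Fm
  neg  : ℕ → Fm
  _∨_  : Fm → Fm → Fm
  _∧_  : Fm → Fm → Fm
  □_   : Fm → Fm
  ■_   : Fm → Fm
  ◇_   : Fm → Fm
  ◆_   : Fm → Fm

‾ : Fm → Fm
‾ (pos a) = neg a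
‾ (neg a) = pos a
‾ (A ∨ B) = ‾ A ∧ ‾ B
‾ (A ∧ B) = ‾ A ∨ ‾ B
‾ (□ A) = ◇ ‾ A
‾ (■ A) = ◆ ‾ A
‾ (◇ A) = □ ‾ A
‾ (◆ A) = ■ ‾ A

-- Kinds of nesting / diamonds: white ∘ (future, ◇) and black • (past, ◆).
data Dia : Set where
  white : Dia
  black : Dia

-- Nested sequents: a list (read up to permutation, via the exchange rule)
-- of formulae and nested structures ∘{Δ}, •{Δ}.
data Item : Set where
  fml : Fm → Item
  str : Dia → List Item → Item

Seq : Set
Seq = List Item

∘[_] : Seq → Item
∘[ Δ ] = str white Δ

•[_] : Seq → Item
•[ Δ ] = str black Δ

-- A path axiom ⟨?⟩₁⋯⟨?⟩ₙ X → ⟨?⟩ X.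
record PathAxiom : Set where
  constructor _⟶_
  field
    premiss    : List Dia
    conclusion : Dia

nest : List Dia → Seq → Seq
nest []       Δ = Δ
nest (d ∷ ds) Δ = [ str d (nest ds Δ) ]

-- Derivability in SKt + P.  The Bool index says whether cut may be used:
-- Der P true  Γ : Γ derivable in SKt + P (with cut)
-- Der P false Γ : Γ derivable in SKt + P without cut.
data Der (P : PathAxiom → Set) (c : Bool) : Seq → Set where
  exch : ∀ {Γ Δ} → Γ ↭ Δ → Der P c Γ → Der P c Δ
  id   : ∀ Γ a → Der P c (Γ ++ fml (pos a) ∷ fml (neg a) ∷ [])
  cut  : ∀ {Γ Δ} A → c ≡ true →
         Der P c (Γ ++ [ fml A ]) → Der P c (Δ ++ [ fml (‾ A) ]) → Der P c (Γ ++ Δ)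
  ∧r   : ∀ {Γ A B} → Der P c (Γ ++ [ fml A ]) → Der P c (Γ ++ [ fml B ]) →
         Der P c (Γ ++ [ fml (A ∧ B) ])
  ∨r   : ∀ {Γ A B} → Der P c (Γ ++ fml A ∷ fml B ∷ []) → Der P c (Γ ++ [ fml (A ∨ B) ])
  ctr  : ∀ {Γ Δ} → Der P c (Γ ++ Δ ++ Δ) → Der P c (Γ ++ Δ)
  wk   : ∀ {Γ} Δ → Der P c Γ → Der P c (Γ ++ Δ)
  rf   : ∀ {Γ Δ} → Der P c (Γ ++ [ ∘[ Δ ] ]) → Der P c (•[ Γ ] ∷ Δ)
  rp   : ∀ {Γ Δ} → Der P c (Γ ++ [ •[ Δ ] ]) → Der P c (∘[ Γ ] ∷ Δ)
  ■r   : ∀ {Γ A} → Der P c (Γ ++ [ •[ [ fml A ] ] ]) → Der P c (Γ ++ [ fml (■ A) ])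
  □r   : ∀ {Γ A} → Der P c (Γ ++ [ ∘[ [ fml A ] ] ]) → Der P c (Γ ++ [ fml (□ A) ])
  ◆r   : ∀ {Γ Δ A} → Der P c (Γ ++ [ •[ Δ ++ [ fml A ] ] ]) →
         Der P c (Γ ++ •[ Δ ] ∷ fml (◆ A) ∷ [])
  ◇r   : ∀ {Γ Δ A} → Der P c (Γ ++ [ ∘[ Δ ++ [ fml A ] ] ]) →
         Der P c (Γ ++ ∘[ Δ ] ∷ fml (◇ A) ∷ [])
  path : ∀ {Γ Δ ds d} → P (ds ⟶ d) →
         Der P c (Γ ++ [ str d Δ ]) → Der P c (Γ ++ nest ds Δ)

-- Cut on A is admissible by a substitution argument: in a cut-free
-- derivation of Γ, A replace the occurrences of A by the context Δ of the
-- other premiss Δ, Ā.  All rules are shallow, so each rule instance survives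
-- the replacement except where the replaced A is principal; there the
-- premisses of that rule are used to replace Ā, in the same way, in the
-- derivation of Δ, Ā.  When Ā is principal in turn, both rules introduce
-- A and Ā and the cut reduces to cuts on immediate subformulae, residuation
-- (rf, rp) bringing the subformulae of the modal rules to the top level.
-- The induction is on the cut formula alone; the path rules, being shallow,
-- commute with every replacement.
module Submission where

open import Defs
open import Data.Bool using (true; false)
open import Data.List using (List; []; _∷_; _++_; [_])
open import Data.List.Properties using (++-assoc; ++-identityʳ)
open import Data.List.Relation.Binary.Permutation.Propositional
open import Data.List.Relation.Binary.Permutation.Propositional.Properties
  using (++⁺ˡ; ++-comm; shifts; ++-commutativeMonoid)
open import Data.Product using (∃; _×_; _,_)
open import Relation.Binary.PropositionalEquality
  using (_≡_; refl; sym; subst; cong)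
open import Algebra.Solver.CommutativeMonoid (++-commutativeMonoid {A = Item})
  using (solve; _⊜_; _⊕_)

-- Replace A Δ S S' : S' arises from S by replacing some occurrences of the
-- formula A, at any depth of nesting, by the sequent Δ.
mutual
  data ReplaceItem (A : Fm) (Δ : Seq) : Item → Seq → Set where
    keep   : ∀ {B} → ReplaceItem A Δ (fml B) [ fml B ]
    here   : ReplaceItem A Δ (fml A) Δ
    inside : ∀ {d T T'} → Replace A Δ T T' → ReplaceItem A Δ (str d T) [ str d T' ]

  data Replace (A : Fm) (Δ : Seq) : Seq → Seq → Set where
    []  : Replace A Δ [] []
    _∷_ : ∀ {x X xs ys} → ReplaceItem A Δ x X → Replace A Δ xs ys →
          Replace A Δ (x ∷ xs) (X ++ ys)

module _ {A : Fm} {Δ : Seq} where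

  mutual
    ReplaceItem-refl : ∀ x → ReplaceItem A Δ x [ x ]
    ReplaceItem-refl (fml B)   = keep
    ReplaceItem-refl (str d T) = inside (Replace-refl T)

    Replace-refl : ∀ xs → Replace A Δ xs xs
    Replace-refl []       = []
    Replace-refl (x ∷ xs) = ReplaceItem-refl x ∷ Replace-refl xs

  Replace-++⁺ : ∀ {xs xs' ys ys'} → Replace A Δ xs xs' → Replace A Δ ys ys' →
                Replace A Δ (xs ++ ys) (xs' ++ ys')
  Replace-++⁺ [] rys = rys
  Replace-++⁺ (_∷_ {X = X} {ys = xs'} i rxs) rys =
    subst (Replace A Δ _) (sym (++-assoc X xs' _)) (i ∷ Replace-++⁺ rxs rys)

  Replace-++ʳ : ∀ {xs xs'} → Replace A Δ xs xs' → ∀ ys → Replace A Δ (xs ++ ys) (xs' ++ ys)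
  Replace-++ʳ rxs ys = Replace-++⁺ rxs (Replace-refl ys)

  data SplitReplace (xs ys : Seq) : Seq → Set where
    split : ∀ {xs' ys'} → Replace A Δ xs xs' → Replace A Δ ys ys' →
            SplitReplace xs ys (xs' ++ ys')

  Replace-++⁻ : ∀ xs {ys S'} → Replace A Δ (xs ++ ys) S' → SplitReplace xs ys S'
  Replace-++⁻ []       r = split [] r
  Replace-++⁻ (x ∷ xs) (_∷_ {X = X} i r) with Replace-++⁻ xs r
  ... | split {xs'} {ys'} rxs rys =
    subst (SplitReplace _ _) (++-assoc X xs' ys') (split (i ∷ rxs) rys)

  Replace-[-]⁻ : ∀ {x S'} → Replace A Δ [ x ] S' → ReplaceItem A Δ x S'
  Replace-[-]⁻ (_∷_ {X = X} i []) = subst (ReplaceItem A Δ _) (sym (++-identityʳ X)) i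

  data NestReplace (ds : List Dia) (T : Seq) : Seq → Set where
    nested : ∀ {T'} → Replace A Δ T T' → NestReplace ds T (nest ds T')

  Replace-nest⁻ : ∀ ds {T S'} → Replace A Δ (nest ds T) S' → NestReplace ds T S'
  Replace-nest⁻ []       r               = nested r
  Replace-nest⁻ (d ∷ ds) (inside r ∷ []) with Replace-nest⁻ ds r
  ... | nested rT = nested rT

  Replace-↭ : ∀ {S₁ S₂ S₂'} → S₁ ↭ S₂ → Replace A Δ S₂ S₂' →
              ∃ λ S₁' → Replace A Δ S₁ S₁' × S₁' ↭ S₂'
  Replace-↭ refl r = _ , r , refl
  Replace-↭ (prep x p) (_∷_ {X = X} i r) with Replace-↭ p r
  ... | S' , r' , q = X ++ S' , i ∷ r' , ++⁺ˡ X q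
  Replace-↭ (swap x y p) (_∷_ {X = Y} j (_∷_ {X = X} i r)) with Replace-↭ p r
  ... | S' , r' , q = X ++ Y ++ S' , i ∷ (j ∷ r') , ↭-trans (shifts X Y) (++⁺ˡ Y (++⁺ˡ X q))
  Replace-↭ (trans p q) r with Replace-↭ q r
  ... | S₂' , r₂ , q' with Replace-↭ p r₂
  ... | S₁' , r₁ , p' = S₁' , r₁ , ↭-trans p' q'

↭-rotate : ∀ x (Γ Γ₀ : Seq) → x ∷ Γ ++ Γ₀ ↭ Γ₀ ++ x ∷ Γ
↭-rotate x Γ Γ₀ = solve 3 (λ x Γ Γ₀ → x ⊕ (Γ ⊕ Γ₀) ⊜ Γ₀ ⊕ (x ⊕ Γ)) refl [ x ] Γ Γ₀

↭-front-to-back : ∀ x (Γ Γ₀ : Seq) → x ∷ Γ ++ Γ₀ ↭ Γ ++ Γ₀ ++ [ x ]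
↭-front-to-back x Γ Γ₀ = solve 3 (λ x Γ Γ₀ → x ⊕ (Γ ⊕ Γ₀) ⊜ Γ ⊕ (Γ₀ ⊕ x)) refl [ x ] Γ Γ₀

flip : Dia → Dia
flip white = black
flip black = white

flip-involutive : ∀ d → flip (flip d) ≡ d
flip-involutive white = refl
flip-involutive black = refl

module CutElimination (P : PathAxiom → Set) where

  infix 4 ⊢_
  ⊢_ : Seq → Set
  ⊢ Γ = Der P false Γ

  -- The conclusions of the rules introducing A, with A replaced by Δ.
  Principal : Fm → Seq → Set
  Principal (pos a) Δ = ⊢ Δ ++ [ fml (neg a) ]
  Principal (neg a) Δ = ⊢ Δ ++ [ fml (pos a) ]
  Principal (B ∧ C) Δ = ∀ Γ → ⊢ Γ ++ [ fml B ] → ⊢ Γ ++ [ fml C ] → ⊢ Γ ++ Δ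
  Principal (B ∨ C) Δ = ∀ Γ → ⊢ Γ ++ fml B ∷ fml C ∷ [] → ⊢ Γ ++ Δ
  Principal (□ B)   Δ = ∀ Γ → ⊢ Γ ++ [ ∘[ [ fml B ] ] ] → ⊢ Γ ++ Δ
  Principal (■ B)   Δ = ∀ Γ → ⊢ Γ ++ [ •[ [ fml B ] ] ] → ⊢ Γ ++ Δ
  Principal (◇ B)   Δ = ∀ Γ Σ → ⊢ Γ ++ [ ∘[ Σ ++ [ fml B ] ] ] → ⊢ Γ ++ ∘[ Σ ] ∷ Δ
  Principal (◆ B)   Δ = ∀ Γ Σ → ⊢ Γ ++ [ •[ Σ ++ [ fml B ] ] ] → ⊢ Γ ++ •[ Σ ] ∷ Δ

  replace : ∀ {A Δ S S'} → Principal A Δ → ⊢ S → Replace A Δ S S' → ⊢ S'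
  replace π (exch p d) r with Replace-↭ p r
  ... | _ , r' , q = exch q (replace π d r')
  replace π (id Γ a) r with Replace-++⁻ Γ r
  ... | split {Γ'} rΓ (i ∷ r) with i | Replace-[-]⁻ r
  ...   | keep | keep = id Γ' a
  ...   | keep | here =
    exch (↭-trans (++-comm _ Γ') (++⁺ˡ Γ' (++-comm _ [ fml (pos a) ]))) (wk Γ' π)
  ...   | here | keep = exch (++-comm _ Γ') (wk Γ' π)
  replace π (cut _ () _ _) r
  replace π (∧r {Γ} {B} {C} d₁ d₂) r with Replace-++⁻ Γ r
  ... | split rΓ rA with Replace-[-]⁻ rA
  ...   | keep = ∧r (replace π d₁ (Replace-++ʳ rΓ [ fml B ]))
                  (replace π d₂ (Replace-++ʳ rΓ [ fml C ]))
  ...   | here = π _ (replace π d₁ (Replace-++ʳ rΓ [ fml B ]))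
                   (replace π d₂ (Replace-++ʳ rΓ [ fml C ]))
  replace π (∨r {Γ} {B} {C} d) r with Replace-++⁻ Γ r
  ... | split rΓ rA with Replace-[-]⁻ rA
  ...   | keep = ∨r (replace π d (Replace-++ʳ rΓ (fml B ∷ fml C ∷ [])))
  ...   | here = π _ (replace π d (Replace-++ʳ rΓ (fml B ∷ fml C ∷ [])))
  replace π (ctr {Γ} d) r with Replace-++⁻ Γ r
  ... | split {Γ'} {Θ'} rΓ rΘ =
    ctr {Γ = Γ'} {Δ = Θ'} (replace π d (Replace-++⁺ rΓ (Replace-++⁺ rΘ rΘ)))
  replace π (wk {Γ} Θ d) r with Replace-++⁻ Γ r
  ... | split rΓ rΘ = wk _ (replace π d rΓ)
  replace π (rf d) (inside rΓ ∷ rΘ) = rf (replace π d (Replace-++⁺ rΓ (inside rΘ ∷ [])))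
  replace π (rp d) (inside rΓ ∷ rΘ) = rp (replace π d (Replace-++⁺ rΓ (inside rΘ ∷ [])))
  replace π (■r {Γ} {B} d) r with Replace-++⁻ Γ r
  ... | split rΓ rA with Replace-[-]⁻ rA
  ...   | keep = ■r (replace π d (Replace-++ʳ rΓ [ •[ [ fml B ] ] ]))
  ...   | here = π _ (replace π d (Replace-++ʳ rΓ [ •[ [ fml B ] ] ]))
  replace π (□r {Γ} {B} d) r with Replace-++⁻ Γ r
  ... | split rΓ rA with Replace-[-]⁻ rA
  ...   | keep = □r (replace π d (Replace-++ʳ rΓ [ ∘[ [ fml B ] ] ]))
  ...   | here = π _ (replace π d (Replace-++ʳ rΓ [ ∘[ [ fml B ] ] ]))
  replace π (◆r {Γ} d) r with Replace-++⁻ Γ r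
  ... | split rΓ (inside rΣ ∷ rA) with Replace-[-]⁻ rA
  ...   | keep = ◆r (replace π d (Replace-++⁺ rΓ (inside (Replace-++ʳ rΣ _) ∷ [])))
  ...   | here = π _ _ (replace π d (Replace-++⁺ rΓ (inside (Replace-++ʳ rΣ _) ∷ [])))
  replace π (◇r {Γ} d) r with Replace-++⁻ Γ r
  ... | split rΓ (inside rΣ ∷ rA) with Replace-[-]⁻ rA
  ...   | keep = ◇r (replace π d (Replace-++⁺ rΓ (inside (Replace-++ʳ rΣ _) ∷ [])))
  ...   | here = π _ _ (replace π d (Replace-++⁺ rΓ (inside (Replace-++ʳ rΣ _) ∷ [])))
  replace π (path {Γ} {ds = ds} p d) r with Replace-++⁻ Γ r
  ... | split rΓ rN with Replace-nest⁻ ds rN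
  ...   | nested rΘ = path p (replace π d (Replace-++⁺ rΓ (inside rΘ ∷ [])))

  replace-last : ∀ {A Γ Δ} → ⊢ Γ ++ [ fml A ] → Principal A Δ → ⊢ Γ ++ Δ
  replace-last {Γ = Γ} {Δ} d π =
    subst ⊢_ (cong (Γ ++_) (++-identityʳ Δ))
      (replace π d (Replace-++⁺ (Replace-refl Γ) (here ∷ [])))

  CutAdmissible : Fm → Fm → Set
  CutAdmissible B B' = ∀ {Γ Δ} → ⊢ Γ ++ [ fml B ] → ⊢ Δ ++ [ fml B' ] → ⊢ Γ ++ Δ

  CutAdmissible-sym : ∀ {B B'} → CutAdmissible B B' → CutAdmissible B' B
  CutAdmissible-sym cutBB′ {Γ} {Δ} d e = exch (++-comm Δ Γ) (cutBB′ e d)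

  residuate : ∀ d {Γ Δ} → ⊢ Γ ++ [ str d Δ ] → ⊢ str (flip d) Γ ∷ Δ
  residuate white = rf
  residuate black = rp

  ∧∨-reduction : ∀ {B B' C C' Γ Δ} → CutAdmissible B B' → CutAdmissible C C' →
                 ⊢ Γ ++ [ fml B ] → ⊢ Γ ++ [ fml C ] → ⊢ Δ ++ fml B' ∷ fml C' ∷ [] →
                 ⊢ Γ ++ Δ
  ∧∨-reduction {B' = B'} {C' = C'} {Γ} {Δ} cutB cutC d₁ d₂ e =
    exch (++-comm Δ Γ) (ctr {Γ = Δ} {Δ = Γ}
      (exch (solve 2 (λ Γ Δ → Γ ⊕ (Γ ⊕ Δ) ⊜ Δ ⊕ (Γ ⊕ Γ)) refl Γ Δ) (cutC d₂ ⊢Γ,Δ,C')))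
    where
    ⊢Δ,C',B' : ⊢ (Δ ++ [ fml C' ]) ++ [ fml B' ]
    ⊢Δ,C',B' = exch (solve 3 (λ Δ b c → Δ ⊕ (b ⊕ c) ⊜ (Δ ⊕ c) ⊕ b) refl Δ [ fml B' ] [ fml C' ]) e
    ⊢Γ,Δ,C' : ⊢ (Γ ++ Δ) ++ [ fml C' ]
    ⊢Γ,Δ,C' = exch (solve 3 (λ Γ Δ c → Γ ⊕ (Δ ⊕ c) ⊜ (Γ ⊕ Δ) ⊕ c) refl Γ Δ [ fml C' ])
                   (cutB d₁ ⊢Δ,C',B')

  -- Residuating both premisses around the common context Γ, Γ' brings B and
  -- B' to the top level.
  box-diamond-reduction : ∀ {B B' Γ Γ' Σ} → CutAdmissible B B' → ∀ d →
                          ⊢ Γ ++ [ str d [ fml B ] ] → ⊢ Γ' ++ [ str d (Σ ++ [ fml B' ]) ] →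
                          ⊢ str d Σ ∷ Γ ++ Γ'
  box-diamond-reduction {B} {B'} {Γ} {Γ'} {Σ} cutB d dB dB' =
    subst (λ d' → ⊢ str d' Σ ∷ Γ ++ Γ') (flip-involutive d)
      (residuate (flip d) (ctr {Γ = Σ} {Δ = [ s ]}
        (exch (solve 2 (λ s Σ → s ⊕ (s ⊕ Σ) ⊜ Σ ⊕ (s ⊕ s)) refl [ s ] Σ)
          (cutB {Γ = [ s ]} {Δ = s ∷ Σ} ⊢s,B ⊢s,Σ,B'))))
    where
    s : Item
    s = str (flip d) (Γ ++ Γ')
    ⊢s,B : ⊢ s ∷ [ fml B ]
    ⊢s,B = residuate d (exch (solve 3 (λ Γ x Γ' → (Γ ⊕ x) ⊕ Γ' ⊜ (Γ ⊕ Γ') ⊕ x)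
                                      refl Γ [ str d [ fml B ] ] Γ')
                             (wk Γ' dB))
    ⊢s,Σ,B' : ⊢ s ∷ Σ ++ [ fml B' ]
    ⊢s,Σ,B' = residuate d (exch (solve 3 (λ Γ x Γ' → (Γ' ⊕ x) ⊕ Γ ⊜ (Γ ⊕ Γ') ⊕ x)
                                         refl Γ [ str d (Σ ++ [ fml B' ]) ] Γ')
                                (wk Γ dB'))

  mutual
    cut-admissible : ∀ A → CutAdmissible A (‾ A)
    cut-admissible A d e = replace-last d (principal A e)

    principal : ∀ A {Δ} → ⊢ Δ ++ [ fml (‾ A) ] → Principal A Δ
    principal (pos a) e = e
    principal (neg a) e = e
    principal (B ∧ C) {Δ} e Γ d₁ d₂ =
      exch (++-comm Δ Γ) (replace-last e λ Γ₀ e' →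
        exch (++-comm Γ Γ₀) (∧∨-reduction (cut-admissible B) (cut-admissible C) d₁ d₂ e'))
    principal (B ∨ C) {Δ} e Γ d =
      exch (++-comm Δ Γ) (replace-last e λ Γ₀ e₁ e₂ →
        ∧∨-reduction (CutAdmissible-sym (cut-admissible B))
                     (CutAdmissible-sym (cut-admissible C)) e₁ e₂ d)
    principal (□ B) {Δ} e Γ d =
      exch (++-comm Δ Γ) (replace-last e λ Γ₀ Σ e' →
        exch (↭-rotate ∘[ Σ ] Γ Γ₀) (box-diamond-reduction (cut-admissible B) white d e'))
    principal (■ B) {Δ} e Γ d =
      exch (++-comm Δ Γ) (replace-last e λ Γ₀ Σ e' →
        exch (↭-rotate •[ Σ ] Γ Γ₀) (box-diamond-reduction (cut-admissible B) black d e'))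
    principal (◇ B) {Δ} e Γ Σ d =
      exch (↭-trans (↭-sym (↭-front-to-back ∘[ Σ ] Δ Γ)) (↭-rotate ∘[ Σ ] Δ Γ))
        (replace-last e λ Γ₀ e' →
          exch (↭-front-to-back ∘[ Σ ] Γ₀ Γ)
            (box-diamond-reduction (CutAdmissible-sym (cut-admissible B)) white e' d))
    principal (◆ B) {Δ} e Γ Σ d =
      exch (↭-trans (↭-sym (↭-front-to-back •[ Σ ] Δ Γ)) (↭-rotate •[ Σ ] Δ Γ))
        (replace-last e λ Γ₀ e' →
          exch (↭-front-to-back •[ Σ ] Γ₀ Γ)
            (box-diamond-reduction (CutAdmissible-sym (cut-admissible B)) black e' d))

  cut-elimination : ∀ {Γ} → Der P true Γ → ⊢ Γ
  cut-elimination (exch p d)      = exch p (cut-elimination d)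
  cut-elimination (id Γ a)        = id Γ a
  cut-elimination (cut A _ d e)   = cut-admissible A (cut-elimination d) (cut-elimination e)
  cut-elimination (∧r d e)        = ∧r (cut-elimination d) (cut-elimination e)
  cut-elimination (∨r d)          = ∨r (cut-elimination d)
  cut-elimination (ctr {Γ} {Δ} d) = ctr {Γ = Γ} {Δ = Δ} (cut-elimination d)
  cut-elimination (wk Δ d)        = wk Δ (cut-elimination d)
  cut-elimination (rf d)          = rf (cut-elimination d)
  cut-elimination (rp d)          = rp (cut-elimination d)
  cut-elimination (■r d)          = ■r (cut-elimination d)
  cut-elimination (□r d)          = □r (cut-elimination d)
  cut-elimination (◆r d)          = ◆r (cut-elimination d)
  cut-elimination (◇r d)          = ◇r (cut-elimination d)
  cut-elimination (path p d)      = path p (cut-elimination d)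

theorem6p3 : (P : PathAxiom → Set) (Γ : Seq) → Der P true Γ → Der P false Γ
theorem6p3 P Γ = CutElimination.cut-elimination P
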